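{- Let $w$ be a finite nonempty word. For each letter $a\in\mathrm{Alph}(w)$ let $n_a$ be the largest integer such that $a^{n_a}$ is a factor of $w$, and let $n=\max_{a\in\mathrm{Alph}(w)} n_a$. Then $\mathrm{D}_\infty(w)\le \mathrm{D}(w)+n$. Moreover, if $w$ ends with $a^k$ or begins with $a^k$ for some letter $a$ and some $k\ge 0$, then $\mathrm{D}_\infty(w)\le \mathrm{D}(w)+n_a-k$.
   Context: A palindrome is a word equal to its reversal (the empty word is a palindrome). For a finite word $x$, $\mathrm{Pal}(x)$ is the set of its palindromic factors including the empty word, and its defect is $\mathrm{D}(x)=|x|+1-|\mathrm{Pal}(x)|$. For an infinite word $z$, $\mathrm{D}(z)=\sup\{\mathrm{D}(u): u \text{ a finite factor of } z\}$ ($\infty$ if unbounded). The infinite defect of a finite word $w$ is $\mathrm{D}_\infty(w)=\min\{\mathrm{D}(z): z \text{ an infinite (right, left or two-way) word having } w \text{ as a factor},\ \mathrm{Alph}(z)\subseteq\mathrm{Alph}(w)\}$, $\mathrm{Alph}$ being the set of letters occurring. -}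

module Defs where

open import Data.Nat using (ℕ; _+_; _∸_; _≤_)
open import Data.Integer using (ℤ; +_) renaming (_+_ to _+ℤ_)
open import Data.List using (List; []; _∷_; _++_; length; reverse; inits; tails; concatMap; filter; deduplicate; applyUpTo; replicate)
open import Data.List.Properties using (≡-dec)
open import Data.List.Membership.Propositional using (_∈_)
open import Data.Product using (Σ; ∃; _×_; _,_)
open import Relation.Binary.PropositionalEquality using (_≡_)
open import Relation.Binary.Definitions using (DecidableEquality)
open import Relation.Nullary using (Dec)

Word : Set → Set
Word A = List A

Factor : {A : Set} → Word A → Word A → Set
Factor u w = Σ _ λ p → Σ _ λ s → p ++ u ++ s ≡ w

Prefix : {A : Set} → Word A → Word A → Set
Prefix u w = Σ _ λ s → u ++ s ≡ w

Suffix : {A : Set} → Word A → Word A → Set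
Suffix u w = Σ _ λ p → p ++ u ≡ w

IsPalindrome : {A : Set} → Word A → Set
IsPalindrome x = x ≡ reverse x

module _ {A : Set} (_≟_ : DecidableEquality A) where

  isPal? : (x : Word A) → Dec (IsPalindrome x)
  isPal? x = ≡-dec _≟_ x (reverse x)

  factors : Word A → List (Word A)
  factors x = concatMap inits (tails x)

  -- Pal(x): the distinct palindromic factors of x, including the empty word
  Pal : Word A → List (Word A)
  Pal x = deduplicate (≡-dec _≟_) (filter isPal? (factors x))

  D : Word A → ℕ
  D x = (length x + 1) ∸ length (Pal x)

-- Infinite words: right-infinite z0 z1 z2 ..., left-infinite ... z2 z1 z0,
-- and two-way infinite ... z(-1) z0 z1 ...
data InfWord (A : Set) : Set where
  right  : (ℕ → A) → InfWord A
  left   : (ℕ → A) → InfWord A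
  twoway : (ℤ → A) → InfWord A

FactorInf : {A : Set} → Word A → InfWord A → Set
FactorInf u (right z)  = ∃ λ i → u ≡ applyUpTo (λ j → z (i + j)) (length u)
FactorInf u (left z)   = ∃ λ i → u ≡ reverse (applyUpTo (λ j → z (i + j)) (length u))
FactorInf u (twoway z) = ∃ λ i → u ≡ applyUpTo (λ j → z (i +ℤ + j)) (length u)

AlphSub : {A : Set} → InfWord A → Word A → Set
AlphSub (right z)  w = ∀ i → z i ∈ w
AlphSub (left z)   w = ∀ i → z i ∈ w
AlphSub (twoway z) w = ∀ i → z i ∈ w

DefectInfLe : {A : Set} → DecidableEquality A → InfWord A → ℕ → Set
DefectInfLe _≟_ z m = ∀ u → FactorInf u z → D _≟_ u ≤ m

-- D_∞(w) ≤ m: the minimum over admissible z of D(z) is at most m,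
-- i.e. some admissible z has D(z) ≤ m.
DinfLe : {A : Set} → DecidableEquality A → Word A → ℕ → Set
DinfLe _≟_ w m = Σ (InfWord _) λ z → FactorInf w z × AlphSub z w × DefectInfLe _≟_ z m

IsLargestPower : {A : Set} → A → Word A → ℕ → Set
IsLargestPower a w k = Factor (replicate k a) w × (∀ m → Factor (replicate m a) w → m ≤ k)

IsMaxOverAlph : {A : Set} → Word A → (A → ℕ) → ℕ → Set
IsMaxOverAlph w na n = (Σ _ λ a → a ∈ w × n ≡ na a) × (∀ a → a ∈ w → na a ≤ n)

module Submission where

-- If w ends with a^k, pad it on the right with a^ω (if it begins with a^k, pad it on the left,
-- which is the same by reversal). Defect is monotone on factors, since appending a letter to x
-- creates at most one palindrome not already in x, the longest palindromic suffix. So every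
-- factor of the padded word has defect at most D(w a^J) for some J. In w a^J, which ends with
-- a^(k+J), the powers a^(n_a+1), …, a^(k+J) are palindromes absent from w, so at most
-- n_a − k of the J appended letters fail to contribute a new palindrome. The bound D(w) + n is
-- the case k = 0 for a letter attaining n.

open import Defs
open import Data.Nat using (ℕ; zero; suc; _+_; _∸_; _≤_; _<_; z≤n; s≤s)
open import Data.Nat.Properties
open import Data.Nat.Solver using (module +-*-Solver)
open import Data.List
  using (List; []; _∷_; _++_; _∷ʳ_; [_]; length; reverse; replicate; inits; tails; filter; applyUpTo; initLast; _∷ʳ′_)
open import Data.List.Properties
open import Data.List.Membership.Propositional using (_∈_; find; lose)
open import Data.List.Membership.Propositional.Properties
open import Data.List.Relation.Unary.Any using (here; there)
import Data.List.Relation.Unary.Any.Properties as AnyP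
import Data.List.Relation.Unary.All as All
open import Data.List.Relation.Unary.AllPairs using (_∷_)
open import Data.List.Relation.Unary.Unique.Propositional using (Unique)
import Data.List.Relation.Unary.Unique.Propositional.Properties as Unique
import Data.List.Relation.Unary.Unique.DecPropositional.Properties as DecUnique
open import Data.Product using (_×_; _,_; proj₁; proj₂)
open import Data.Sum using (_⊎_; inj₁; inj₂) renaming ([_,_] to [_,_]′)
open import Data.Empty using (⊥-elim)
open import Function using (case_of_)
open import Relation.Nullary using (¬_; yes; no)
open import Relation.Binary.Definitions using (DecidableEquality)
open import Relation.Binary.PropositionalEquality
  using (_≡_; _≢_; refl; sym; trans; cong; cong₂; subst; subst₂; module ≡-Reasoning)

m+n∸o≤m∸o+n : ∀ m n o → (m + n) ∸ o ≤ (m ∸ o) + n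
m+n∸o≤m∸o+n m       n zero    = ≤-refl
m+n∸o≤m∸o+n zero    n (suc o) = m∸n≤m n (suc o)
m+n∸o≤m∸o+n (suc m) n (suc o) = m+n∸o≤m∸o+n m n o

module _ {A : Set} where

  unique⊆⇒length≤ : {xs ys : List A} → Unique xs → (∀ {x} → x ∈ xs → x ∈ ys) →
                    length xs ≤ length ys
  unique⊆⇒length≤ {[]}     _          _  = z≤n
  unique⊆⇒length≤ {x ∷ xs} {ys} (x∉xs ∷ xs!) xs⊆ys
    with ys₁ , ys₂ , refl ← ∈-∃++ (xs⊆ys (here refl)) = begin
      suc (length xs)             ≤⟨ s≤s (unique⊆⇒length≤ xs! xs⊆ys₁++ys₂) ⟩
      suc (length (ys₁ ++ ys₂))   ≡⟨ cong suc (length-++ ys₁) ⟩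
      suc (length ys₁ + length ys₂) ≡⟨ sym (+-suc (length ys₁) (length ys₂)) ⟩
      length ys₁ + length (x ∷ ys₂) ≡⟨ sym (length-++ ys₁) ⟩
      length (ys₁ ++ x ∷ ys₂)     ∎
    where
    open ≤-Reasoning
    xs⊆ys₁++ys₂ : ∀ {z} → z ∈ xs → z ∈ ys₁ ++ ys₂
    xs⊆ys₁++ys₂ {z} z∈xs with ∈-++⁻ ys₁ (xs⊆ys (there z∈xs))
    ... | inj₁ z∈ys₁        = ∈-++⁺ˡ z∈ys₁
    ... | inj₂ (here refl)  = ⊥-elim (All.lookup x∉xs z∈xs refl)
    ... | inj₂ (there z∈ys₂) = ∈-++⁺ʳ ys₁ z∈ys₂

  Prefix⇒Factor : {u x : List A} → Prefix u x → Factor u x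
  Prefix⇒Factor (s , eq) = [] , s , eq

  Suffix⇒Factor : {u x : List A} → Suffix u x → Factor u x
  Suffix⇒Factor {u} (p , eq) = p , [] , trans (cong (p ++_) (++-identityʳ u)) eq

  Factor-++ʳ : {u x : List A} (y : List A) → Factor u x → Factor u (x ++ y)
  Factor-++ʳ {u} y (p , s , refl) =
    p , s ++ y , trans (cong (p ++_) (sym (++-assoc u s y))) (sym (++-assoc p (u ++ s) y))

  Factor-++ˡ : {u y : List A} (x : List A) → Factor u y → Factor u (x ++ y)
  Factor-++ˡ {u} x (p , s , refl) = x ++ p , s , ++-assoc x p (u ++ s)

  Factor-trans : {u x y : List A} → Factor u x → Factor x y → Factor u y
  Factor-trans u⊑x (q , t , refl) = Factor-++ˡ q (Factor-++ʳ t u⊑x)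

  Factor-reverse : {u x : List A} → Factor u x → Factor (reverse u) (reverse x)
  Factor-reverse {u} (p , s , refl) = reverse s , reverse p , sym (begin
      reverse (p ++ u ++ s)               ≡⟨ reverse-++ p (u ++ s) ⟩
      reverse (u ++ s) ++ reverse p       ≡⟨ cong (_++ reverse p) (reverse-++ u s) ⟩
      (reverse s ++ reverse u) ++ reverse p ≡⟨ ++-assoc (reverse s) (reverse u) (reverse p) ⟩
      reverse s ++ reverse u ++ reverse p ∎)
    where open ≡-Reasoning

  Prefix-reverse : {u x : List A} → Prefix u x → Suffix (reverse u) (reverse x)
  Prefix-reverse {u} (s , refl) = reverse s , sym (reverse-++ u s)

  palindrome-Factor-reverse⁻ : {u x : List A} → IsPalindrome u → Factor u (reverse x) → Factor u x
  palindrome-Factor-reverse⁻ {u} {x} u-pal u⊑x̃ =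
    subst₂ Factor (sym u-pal) (reverse-involutive x) (Factor-reverse u⊑x̃)

  ++-∷ʳ-injectiveˡ : (p u s x : List A) {b c : A} → p ++ u ++ s ∷ʳ c ≡ x ∷ʳ b → p ++ u ++ s ≡ x
  ++-∷ʳ-injectiveˡ p u s x {c = c} eq = ∷ʳ-injectiveˡ (p ++ u ++ s) x (begin
      (p ++ u ++ s) ∷ʳ c   ≡⟨ ++-assoc p (u ++ s) [ c ] ⟩
      p ++ (u ++ s) ∷ʳ c   ≡⟨ cong (p ++_) (++-assoc u s [ c ]) ⟩
      p ++ u ++ s ∷ʳ c     ≡⟨ eq ⟩
      x ∷ʳ _               ∎)
    where open ≡-Reasoning

  Factor-∷ʳ⁻ : {u x : List A} {b : A} → Factor u (x ∷ʳ b) → Factor u x ⊎ Suffix u (x ∷ʳ b)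
  Factor-∷ʳ⁻ {u} {x} (p , s , eq) with initLast s
  ... | []       = inj₂ (p , trans (cong (p ++_) (sym (++-identityʳ u))) eq)
  ... | s′ ∷ʳ′ c = inj₁ (p , s′ , ++-∷ʳ-injectiveˡ p u s′ x eq)

  length-Suffix : {s y : List A} → Suffix s y → length s ≤ length y
  length-Suffix {s} (p , refl) = ≤-trans (m≤n+m (length s) (length p)) (≤-reflexive (sym (length-++ p)))

  Suffix-of-Suffix : {s q y : List A} → Suffix s y → Suffix q y → length s ≤ length q → Suffix s q
  Suffix-of-Suffix (p₁ , refl) ([] , q≡y) _ = p₁ , sym q≡y
  Suffix-of-Suffix ([] , refl) (b ∷ p₂ , refl) s≤q =
    ⊥-elim (<⇒≱ (s≤s (length-Suffix (p₂ , refl))) s≤q)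
  Suffix-of-Suffix (c ∷ p₁ , refl) (b ∷ p₂ , eq) s≤q =
    Suffix-of-Suffix (p₁ , refl) (p₂ , ∷-injectiveʳ eq) s≤q

  palindrome-Suffix⇒Prefix : {s q : List A} → IsPalindrome s → IsPalindrome q → Suffix s q → Prefix s q
  palindrome-Suffix⇒Prefix {s} {q} s-pal q-pal (p , eq) = reverse p , sym (begin
      q                     ≡⟨ q-pal ⟩
      reverse q             ≡⟨ cong reverse (sym eq) ⟩
      reverse (p ++ s)      ≡⟨ reverse-++ p s ⟩
      reverse s ++ reverse p ≡⟨ cong (_++ reverse p) (sym s-pal) ⟩
      s ++ reverse p        ∎)
    where open ≡-Reasoning

  shorter-Prefix-of-Suffix-∷ʳ : {s q x : List A} {b : A} → Prefix s q → Suffix q (x ∷ʳ b) →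
                                length s < length q → Factor s x
  shorter-Prefix-of-Suffix-∷ʳ {s} {x = x} (t , refl) (p , eq) s<q with initLast t
  ... | [] = ⊥-elim (<-irrefl (cong length (sym (++-identityʳ s))) s<q)
  ... | t′ ∷ʳ′ c = p , t′ , ++-∷ʳ-injectiveˡ p s t′ x eq

  replicate-+ : ∀ m n (a : A) → replicate m a ++ replicate n a ≡ replicate (m + n) a
  replicate-+ zero    n a = refl
  replicate-+ (suc m) n a = cong (a ∷_) (replicate-+ m n a)

  replicate-∷ʳ : ∀ m (a : A) → replicate m a ∷ʳ a ≡ a ∷ replicate m a
  replicate-∷ʳ m a = trans (replicate-+ m 1 a) (cong (λ k → replicate k a) (+-comm m 1))

  replicate-palindrome : ∀ m (a : A) → IsPalindrome (replicate m a)
  replicate-palindrome zero    a = refl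
  replicate-palindrome (suc m) a = sym (begin
      reverse (a ∷ replicate m a)   ≡⟨ unfold-reverse a (replicate m a) ⟩
      reverse (replicate m a) ∷ʳ a  ≡⟨ cong (_∷ʳ a) (sym (replicate-palindrome m a)) ⟩
      replicate m a ∷ʳ a            ≡⟨ replicate-∷ʳ m a ⟩
      a ∷ replicate m a             ∎)
    where open ≡-Reasoning

  replicate-Prefix : ∀ {m n} (a : A) → m ≤ n → Prefix (replicate m a) (replicate n a)
  replicate-Prefix {m} {n} a m≤n =
    replicate (n ∸ m) a , trans (replicate-+ m (n ∸ m) a) (cong (λ k → replicate k a) (m+[n∸m]≡n m≤n))

  ∈-inits⁻ : ∀ {p : List A} x → p ∈ inits x → Prefix p x
  ∈-inits⁻ []      (here refl) = [] , refl
  ∈-inits⁻ (b ∷ x) (here refl) = b ∷ x , refl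
  ∈-inits⁻ (b ∷ x) (there p∈)
    with q , q∈ , refl ← ∈-map⁻ (b ∷_) p∈
    with s , refl ← ∈-inits⁻ x q∈ = s , refl

  ∈-inits⁺ : ∀ (p s : List A) → p ∈ inits (p ++ s)
  ∈-inits⁺ []      []      = here refl
  ∈-inits⁺ []      (b ∷ s) = here refl
  ∈-inits⁺ (b ∷ p) s       = there (∈-map⁺ (b ∷_) (∈-inits⁺ p s))

  ∈-tails⁻ : ∀ {s : List A} x → s ∈ tails x → Suffix s x
  ∈-tails⁻ []      (here refl) = [] , refl
  ∈-tails⁻ (b ∷ x) (here refl) = [] , refl
  ∈-tails⁻ (b ∷ x) (there s∈) with p , refl ← ∈-tails⁻ x s∈ = b ∷ p , refl

  ∈-tails⁺ : ∀ (p s : List A) → s ∈ tails (p ++ s)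
  ∈-tails⁺ []      []      = here refl
  ∈-tails⁺ []      (b ∷ s) = here refl
  ∈-tails⁺ (b ∷ p) s       = there (∈-tails⁺ p s)

module _ {A : Set} (_≟_ : DecidableEquality A) where

  ∈-factors⁻ : ∀ {u} x → u ∈ factors _≟_ x → Factor u x
  ∈-factors⁻ x u∈ with find (∈-concatMap⁻ inits {xs = tails x} u∈)
  ... | t , t∈ , u∈t with ∈-tails⁻ x t∈ | ∈-inits⁻ t u∈t
  ... | p , refl | s , refl = p , s , refl

  ∈-factors⁺ : ∀ {u} x → Factor u x → u ∈ factors _≟_ x
  ∈-factors⁺ x (p , s , refl) = ∈-concatMap⁺ inits (lose (∈-tails⁺ p (_ ++ s)) (∈-inits⁺ _ s))

  ∈-Pal⁻ : ∀ {u} x → u ∈ Pal _≟_ x → Factor u x × IsPalindrome u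
  ∈-Pal⁻ x u∈ with u∈f , u-pal ← ∈-filter⁻ (isPal? _≟_) (∈-deduplicate⁻ (≡-dec _≟_) _ u∈) =
    ∈-factors⁻ x u∈f , u-pal

  ∈-Pal⁺ : ∀ {u} x → Factor u x → IsPalindrome u → u ∈ Pal _≟_ x
  ∈-Pal⁺ x u⊑x u-pal = ∈-deduplicate⁺ (≡-dec _≟_) (∈-filter⁺ (isPal? _≟_) (∈-factors⁺ x u⊑x) u-pal)

  Pal-unique : ∀ x → Unique (Pal _≟_ x)
  Pal-unique x = DecUnique.deduplicate-! (≡-dec _≟_) (filter (isPal? _≟_) (factors _≟_ x))

  length-Pal-≤ : ∀ x (L : List (List A)) → (∀ {u} → Factor u x → IsPalindrome u → u ∈ L) →
                 length (Pal _≟_ x) ≤ length L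
  length-Pal-≤ x L pals∈L = unique⊆⇒length≤ (Pal-unique x) λ u∈ →
    let u⊑x , u-pal = ∈-Pal⁻ x u∈ in pals∈L u⊑x u-pal

  length-Pal-+ : ∀ {x y} (M : List (List A)) → Unique M → Factor x y →
                 (∀ {u} → u ∈ M → Factor u y × IsPalindrome u × ¬ Factor u x) →
                 length (Pal _≟_ x) + length M ≤ length (Pal _≟_ y)
  length-Pal-+ {x} {y} M M! x⊑y new = begin
      length (Pal _≟_ x) + length M  ≡⟨ sym (length-++ (Pal _≟_ x)) ⟩
      length (Pal _≟_ x ++ M)       ≤⟨ unique⊆⇒length≤ (Unique.++⁺ (Pal-unique x) M! disjoint) ⊆Pal-y ⟩
      length (Pal _≟_ y)            ∎
    where
    open ≤-Reasoning
    disjoint : ∀ {u} → ¬ (u ∈ Pal _≟_ x × u ∈ M)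
    disjoint (u∈Pal , u∈M) = proj₂ (proj₂ (new u∈M)) (proj₁ (∈-Pal⁻ x u∈Pal))
    ⊆Pal-y : ∀ {u} → u ∈ Pal _≟_ x ++ M → u ∈ Pal _≟_ y
    ⊆Pal-y u∈ with ∈-++⁻ (Pal _≟_ x) u∈
    ... | inj₁ u∈Pal = let u⊑x , u-pal = ∈-Pal⁻ x u∈Pal in
                       ∈-Pal⁺ y (Factor-trans u⊑x x⊑y) u-pal
    ... | inj₂ u∈M   = let u⊑y , u-pal , _ = new u∈M in ∈-Pal⁺ y u⊑y u-pal

  longestPalSuffix : List A → List A
  longestPalSuffix []      = []
  longestPalSuffix (b ∷ y) with isPal? _≟_ (b ∷ y)
  ... | yes _ = b ∷ y
  ... | no  _ = longestPalSuffix y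

  longestPalSuffix-Suffix : ∀ y → Suffix (longestPalSuffix y) y
  longestPalSuffix-Suffix []      = [] , refl
  longestPalSuffix-Suffix (b ∷ y) with isPal? _≟_ (b ∷ y)
  ... | yes _ = [] , refl
  ... | no  _ with p , eq ← longestPalSuffix-Suffix y = b ∷ p , cong (b ∷_) eq

  longestPalSuffix-palindrome : ∀ y → IsPalindrome (longestPalSuffix y)
  longestPalSuffix-palindrome []      = refl
  longestPalSuffix-palindrome (b ∷ y) with isPal? _≟_ (b ∷ y)
  ... | yes by-pal = by-pal
  ... | no  _      = longestPalSuffix-palindrome y

  longestPalSuffix-longest : ∀ {s} y → Suffix s y → IsPalindrome s →
                             s ≡ longestPalSuffix y ⊎ length s < length (longestPalSuffix y)
  longestPalSuffix-longest []      ([] , eq) _ = inj₁ eq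
  longestPalSuffix-longest (b ∷ y) ([] , refl) s-pal with isPal? _≟_ (b ∷ y)
  ... | yes _      = inj₁ refl
  ... | no  ¬s-pal = ⊥-elim (¬s-pal s-pal)
  longestPalSuffix-longest (b ∷ y) (c ∷ p , eq) s-pal with isPal? _≟_ (b ∷ y)
  ... | yes _ = inj₂ (s≤s (length-Suffix (p , ∷-injectiveʳ eq)))
  ... | no  _ = longestPalSuffix-longest y (p , ∷-injectiveʳ eq) s-pal

  -- A shorter palindromic suffix of x b is a suffix, hence by reflection a prefix, of the
  -- longest one, so it stops before the last letter.
  palindrome-Factor-∷ʳ⁻ : ∀ {u} x (b : A) → Factor u (x ∷ʳ b) → IsPalindrome u →
                          Factor u x ⊎ u ≡ longestPalSuffix (x ∷ʳ b)
  palindrome-Factor-∷ʳ⁻ x b u⊑xb u-pal with Factor-∷ʳ⁻ u⊑xb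
  ... | inj₁ u⊑x = inj₁ u⊑x
  ... | inj₂ u-suf with longestPalSuffix-longest (x ∷ʳ b) u-suf u-pal
  ... | inj₁ u≡q = inj₂ u≡q
  ... | inj₂ u<q = inj₁ (shorter-Prefix-of-Suffix-∷ʳ u-prefix-q q-suf u<q)
    where
    q : List A
    q = longestPalSuffix (x ∷ʳ b)
    q-suf : Suffix q (x ∷ʳ b)
    q-suf = longestPalSuffix-Suffix (x ∷ʳ b)
    u-prefix-q : Prefix _ q
    u-prefix-q = palindrome-Suffix⇒Prefix u-pal (longestPalSuffix-palindrome (x ∷ʳ b))
                   (Suffix-of-Suffix u-suf q-suf (<⇒≤ u<q))

  length-Pal-∷ʳ : ∀ x (b : A) → length (Pal _≟_ (x ∷ʳ b)) ≤ suc (length (Pal _≟_ x))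
  length-Pal-∷ʳ x b = length-Pal-≤ (x ∷ʳ b) (longestPalSuffix (x ∷ʳ b) ∷ Pal _≟_ x) λ u⊑xb u-pal →
    case palindrome-Factor-∷ʳ⁻ x b u⊑xb u-pal of λ where
      (inj₁ u⊑x)  → there (∈-Pal⁺ x u⊑x u-pal)
      (inj₂ refl) → here refl

  D-∷ʳ : ∀ x (b : A) → D _≟_ x ≤ D _≟_ (x ∷ʳ b)
  D-∷ʳ x b = begin
      (length x + 1) ∸ length (Pal _≟_ x)            ≤⟨ ∸-monoʳ-≤ (suc (length x + 1)) (length-Pal-∷ʳ x b) ⟩
      suc (length x + 1) ∸ length (Pal _≟_ (x ∷ʳ b)) ≡⟨ cong (_∸ length (Pal _≟_ (x ∷ʳ b))) length-x∷ʳb+1 ⟩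
      (length (x ∷ʳ b) + 1) ∸ length (Pal _≟_ (x ∷ʳ b)) ∎
    where
    open ≤-Reasoning
    length-x∷ʳb+1 : suc (length x + 1) ≡ length (x ∷ʳ b) + 1
    length-x∷ʳb+1 = trans (+-comm 1 (length x + 1)) (cong (_+ 1) (sym (length-++ x)))

  length-Pal-reverse-≤ : ∀ x → length (Pal _≟_ x) ≤ length (Pal _≟_ (reverse x))
  length-Pal-reverse-≤ x = length-Pal-≤ x (Pal _≟_ (reverse x)) λ {u} u⊑x u-pal →
    ∈-Pal⁺ (reverse x) (subst (λ v → Factor v (reverse x)) (sym u-pal) (Factor-reverse u⊑x)) u-pal

  D-reverse : ∀ x → D _≟_ (reverse x) ≡ D _≟_ x
  D-reverse x = cong₂ _∸_ (cong (_+ 1) (length-reverse x)) (≤-antisym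
    (subst (λ v → length (Pal _≟_ (reverse x)) ≤ length (Pal _≟_ v)) (reverse-involutive x)
      (length-Pal-reverse-≤ (reverse x)))
    (length-Pal-reverse-≤ x))

  D-∷ : ∀ x (b : A) → D _≟_ x ≤ D _≟_ (b ∷ x)
  D-∷ x b = begin
      D _≟_ x                  ≡⟨ D-reverse x ⟨
      D _≟_ (reverse x)        ≤⟨ D-∷ʳ (reverse x) b ⟩
      D _≟_ (reverse x ∷ʳ b)   ≡⟨ cong (D _≟_) (unfold-reverse b x) ⟨
      D _≟_ (reverse (b ∷ x))  ≡⟨ D-reverse (b ∷ x) ⟩
      D _≟_ (b ∷ x)            ∎
    where open ≤-Reasoning

  D-++ʳ : ∀ x y → D _≟_ x ≤ D _≟_ (x ++ y)
  D-++ʳ x []      = ≤-reflexive (cong (D _≟_) (sym (++-identityʳ x)))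
  D-++ʳ x (b ∷ y) = begin
      D _≟_ x               ≤⟨ D-∷ʳ x b ⟩
      D _≟_ (x ∷ʳ b)        ≤⟨ D-++ʳ (x ∷ʳ b) y ⟩
      D _≟_ ((x ∷ʳ b) ++ y) ≡⟨ cong (D _≟_) (++-assoc x [ b ] y) ⟩
      D _≟_ (x ++ b ∷ y)    ∎
    where open ≤-Reasoning

  D-++ˡ : ∀ x y → D _≟_ y ≤ D _≟_ (x ++ y)
  D-++ˡ []      y = ≤-refl
  D-++ˡ (b ∷ x) y = ≤-trans (D-++ˡ x y) (D-∷ (x ++ y) b)

  Factor⇒D≤ : ∀ {u x} → Factor u x → D _≟_ u ≤ D _≟_ x
  Factor⇒D≤ {u} (p , s , refl) = ≤-trans (D-++ʳ u s) (D-++ˡ p (u ++ s))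

  length-Pal-replicate : ∀ {x y} (a : A) N c → (∀ m → Factor (replicate m a) x → m ≤ N) →
                         Factor x y → Factor (replicate (N + c) a) y →
                         length (Pal _≟_ x) + c ≤ length (Pal _≟_ y)
  length-Pal-replicate {x} {y} a N c x-powers≤N x⊑y aᴺ⁺ᶜ⊑y = begin
      length (Pal _≟_ x) + c                ≡⟨ cong (length (Pal _≟_ x) +_) (length-applyUpTo power c) ⟨
      length (Pal _≟_ x) + length powers    ≤⟨ length-Pal-+ powers powers-unique x⊑y new ⟩
      length (Pal _≟_ y)                    ∎
    where
    open ≤-Reasoning
    power : ℕ → List A
    power i = replicate (N + suc i) a
    powers : List (List A)
    powers = applyUpTo power c
    powers-unique : Unique powers
    powers-unique = Unique.applyUpTo⁺₁ power c λ {i} {j} i<j _ eq →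
      <-irrefl (+-cancelˡ-≡ N (suc i) (suc j)
        (trans (sym (length-replicate (N + suc i))) (trans (cong length eq) (length-replicate (N + suc j)))))
        (s≤s i<j)
    new : ∀ {u} → u ∈ powers → Factor u y × IsPalindrome u × ¬ Factor u x
    new u∈ with i , i<c , refl ← ∈-applyUpTo⁻ power u∈ =
      Factor-trans (Prefix⇒Factor (replicate-Prefix a (+-monoʳ-≤ N i<c))) aᴺ⁺ᶜ⊑y ,
      replicate-palindrome (N + suc i) a ,
      λ power⊑x → m+1+n≰m N (x-powers≤N (N + suc i) power⊑x)

  -- With c = J ∸ e, pass to the longer word w a^(e+c): its c palindromes a^(k+e+1), …, a^(k+e+c)
  -- are absent from w and pay for all but e of the appended letters.
  D-++-replicate : ∀ {w} (a : A) k e → Suffix (replicate k a) w →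
                   (∀ m → Factor (replicate m a) w → m ≤ k + e) →
                   ∀ J → D _≟_ (w ++ replicate J a) ≤ D _≟_ w + e
  D-++-replicate {w} a k e (p , refl) w-powers≤ J = begin
      D _≟_ (w ++ replicate J a)                   ≤⟨ Factor⇒D≤ (Prefix⇒Factor wJ-prefix-y) ⟩
      (length y + 1) ∸ length (Pal _≟_ y)          ≤⟨ ∸-monoʳ-≤ (length y + 1) Pal-y≥ ⟩
      (length y + 1) ∸ (length (Pal _≟_ w) + c)    ≡⟨ cong (_∸ (length (Pal _≟_ w) + c)) length-y+1 ⟩
      ((L + e) + c) ∸ (length (Pal _≟_ w) + c)     ≡⟨ cong₂ _∸_ (+-comm (L + e) c) (+-comm (length (Pal _≟_ w)) c) ⟩
      (c + (L + e)) ∸ (c + length (Pal _≟_ w))     ≡⟨ [m+n]∸[m+o]≡n∸o c (L + e) (length (Pal _≟_ w)) ⟩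
      (L + e) ∸ length (Pal _≟_ w)                 ≤⟨ m+n∸o≤m∸o+n L e (length (Pal _≟_ w)) ⟩
      D _≟_ w + e                                  ∎
    where
    open ≤-Reasoning
    open +-*-Solver using (solve; _:+_; _:=_; con)
    c : ℕ
    c = J ∸ e
    L : ℕ
    L = length w + 1
    y : List A
    y = w ++ replicate (e + c) a
    wJ-prefix-y : Prefix (w ++ replicate J a) y
    wJ-prefix-y with t , eq ← replicate-Prefix a (m≤n+m∸n J e) =
      t , trans (++-assoc w (replicate J a) t) (cong (w ++_) eq)
    aᴺ⁺ᶜ-suffix-y : Suffix (replicate (k + (e + c)) a) y
    aᴺ⁺ᶜ-suffix-y = p , sym (trans (++-assoc p (replicate k a) (replicate (e + c) a))
                                   (cong (p ++_) (replicate-+ k (e + c) a)))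
    Pal-y≥ : length (Pal _≟_ w) + c ≤ length (Pal _≟_ y)
    Pal-y≥ = length-Pal-replicate a (k + e) c w-powers≤ (Prefix⇒Factor (replicate (e + c) a , refl))
               (subst (λ n → Factor (replicate n a) y) (sym (+-assoc k e c)) (Suffix⇒Factor aᴺ⁺ᶜ-suffix-y))
    length-y+1 : length y + 1 ≡ (L + e) + c
    length-y+1 = begin-equality
      length y + 1                                     ≡⟨ cong (_+ 1) (length-++ w) ⟩
      (length w + length (replicate (e + c) a)) + 1    ≡⟨ cong (λ n → (length w + n) + 1) (length-replicate (e + c)) ⟩
      (length w + (e + c)) + 1
        ≡⟨ solve 3 (λ l e c → (l :+ (e :+ c)) :+ con 1 := ((l :+ con 1) :+ e) :+ c) refl (length w) e c ⟩
      (L + e) + c                                      ∎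

module _ {A : Set} where

  padRight : A → List A → ℕ → A
  padRight a []      _       = a
  padRight a (b ∷ w) zero    = b
  padRight a (b ∷ w) (suc i) = padRight a w i

  padRight-∈ : ∀ (a : A) w i → padRight a w i ∈ a ∷ w
  padRight-∈ a []      i       = here refl
  padRight-∈ a (b ∷ w) zero    = there (here refl)
  padRight-∈ a (b ∷ w) (suc i) with padRight-∈ a w i
  ... | here eq = here eq
  ... | there m = there (there m)

  applyUpTo-+ : ∀ (f : ℕ → A) m n → applyUpTo f (m + n) ≡ applyUpTo f m ++ applyUpTo (λ j → f (m + j)) n
  applyUpTo-+ f zero    n = refl
  applyUpTo-+ f (suc m) n = cong (f 0 ∷_) (applyUpTo-+ (λ j → f (suc j)) m n)

  applyUpTo-padRight : ∀ (a : A) w n → applyUpTo (padRight a w) (length w + n) ≡ w ++ replicate n a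
  applyUpTo-padRight a []      zero    = refl
  applyUpTo-padRight a []      (suc n) = cong (a ∷_) (applyUpTo-padRight a [] n)
  applyUpTo-padRight a (b ∷ w) n       = cong (b ∷_) (applyUpTo-padRight a w n)

  applyUpTo-padRight-length : ∀ (a : A) w → applyUpTo (padRight a w) (length w) ≡ w
  applyUpTo-padRight-length a w = begin
      applyUpTo (padRight a w) (length w)      ≡⟨ cong (applyUpTo (padRight a w)) (+-identityʳ (length w)) ⟨
      applyUpTo (padRight a w) (length w + 0)  ≡⟨ applyUpTo-padRight a w 0 ⟩
      w ++ []                                  ≡⟨ ++-identityʳ w ⟩
      w                                        ∎
    where open ≡-Reasoning

  padRight-Factor : ∀ (a : A) w i n →
                    Factor (applyUpTo (λ j → padRight a w (i + j)) n) (w ++ replicate (i + n) a)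
  padRight-Factor a w i n = Factor-trans
    (Suffix⇒Factor (applyUpTo z i , sym (applyUpTo-+ z i n)))
    (Prefix⇒Factor (applyUpTo (λ j → z (i + n + j)) (length w) , (begin
      applyUpTo z (i + n) ++ applyUpTo (λ j → z (i + n + j)) (length w)  ≡⟨ applyUpTo-+ z (i + n) (length w) ⟨
      applyUpTo z (i + n + length w)                                     ≡⟨ cong (applyUpTo z) (+-comm (i + n) (length w)) ⟩
      applyUpTo z (length w + (i + n))                                   ≡⟨ applyUpTo-padRight a w (i + n) ⟩
      w ++ replicate (i + n) a                                           ∎)))
    where
    open ≡-Reasoning
    z : ℕ → A
    z = padRight a w

module _ {A : Set} (_≟_ : DecidableEquality A) where

  DinfLe-padRight : ∀ {w m} (a : A) → a ∈ w → (∀ J → D _≟_ (w ++ replicate J a) ≤ m) → DinfLe _≟_ w m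
  DinfLe-padRight {w} {m} a a∈w D-bound = right z , (0 , sym (applyUpTo-padRight-length a w)) , alph , defect
    where
    z : ℕ → A
    z = padRight a w
    alph : ∀ i → z i ∈ w
    alph i with padRight-∈ a w i
    ... | here eq = subst (_∈ w) (sym eq) a∈w
    ... | there m = m
    defect : ∀ u → FactorInf u (right z) → D _≟_ u ≤ m
    defect u (i , u≡) = begin
      D _≟_ u                                          ≡⟨ cong (D _≟_) u≡ ⟩
      D _≟_ (applyUpTo (λ j → z (i + j)) (length u))   ≤⟨ Factor⇒D≤ _≟_ (padRight-Factor a w i (length u)) ⟩
      D _≟_ (w ++ replicate (i + length u) a)          ≤⟨ D-bound (i + length u) ⟩
      m                                                ∎
      where open ≤-Reasoning

  -- left (padRight a (reverse w)) is the left-infinite word ⋯aaa w.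
  DinfLe-padLeft : ∀ {w m} (a : A) → a ∈ w → (∀ J → D _≟_ (reverse w ++ replicate J a) ≤ m) →
                   DinfLe _≟_ w m
  DinfLe-padLeft {w} {m} a a∈w D-bound = left z , (0 , sym w≡) , alph , defect
    where
    z : ℕ → A
    z = padRight a (reverse w)
    w≡ : reverse (applyUpTo z (length w)) ≡ w
    w≡ = begin
      reverse (applyUpTo z (length w))            ≡⟨ cong (λ n → reverse (applyUpTo z n)) (length-reverse w) ⟨
      reverse (applyUpTo z (length (reverse w)))  ≡⟨ cong reverse (applyUpTo-padRight-length a (reverse w)) ⟩
      reverse (reverse w)                         ≡⟨ reverse-involutive w ⟩
      w                                           ∎
      where open ≡-Reasoning
    alph : ∀ i → z i ∈ w
    alph i with padRight-∈ a (reverse w) i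
    ... | here eq = subst (_∈ w) (sym eq) a∈w
    ... | there m = AnyP.reverse⁻ m
    defect : ∀ u → FactorInf u (left z) → D _≟_ u ≤ m
    defect u (i , u≡) = begin
      D _≟_ u                                          ≡⟨ cong (D _≟_) u≡ ⟩
      D _≟_ (reverse v)                                ≡⟨ D-reverse _≟_ v ⟩
      D _≟_ v                                          ≤⟨ Factor⇒D≤ _≟_ (padRight-Factor a (reverse w) i (length u)) ⟩
      D _≟_ (reverse w ++ replicate (i + length u) a)  ≤⟨ D-bound (i + length u) ⟩
      m                                                ∎
      where
      open ≤-Reasoning
      v : List A
      v = applyUpTo (λ j → z (i + j)) (length u)

  DinfLe-endPower : ∀ {w} (a : A) k na → a ∈ w → (∀ m → Factor (replicate m a) w → m ≤ na) →
                    Suffix (replicate k a) w ⊎ Prefix (replicate k a) w →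
                    DinfLe _≟_ w (D _≟_ w + na ∸ k)
  DinfLe-endPower {w} a k na a∈w w-powers≤na end =
    subst (DinfLe _≟_ w) (sym (+-∸-assoc (D _≟_ w) k≤na)) (Dinf≤ end)
    where
    k≤na : k ≤ na
    k≤na = w-powers≤na k ([ Suffix⇒Factor , Prefix⇒Factor ]′ end)
    e : ℕ
    e = na ∸ k
    w-powers≤ : ∀ m → Factor (replicate m a) w → m ≤ k + e
    w-powers≤ m aᵐ⊑w = subst (m ≤_) (sym (m+[n∸m]≡n k≤na)) (w-powers≤na m aᵐ⊑w)
    w̃-powers≤ : ∀ m → Factor (replicate m a) (reverse w) → m ≤ k + e
    w̃-powers≤ m aᵐ⊑w̃ = w-powers≤ m (palindrome-Factor-reverse⁻ (replicate-palindrome m a) aᵐ⊑w̃)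
    Dinf≤ : Suffix (replicate k a) w ⊎ Prefix (replicate k a) w → DinfLe _≟_ w (D _≟_ w + e)
    Dinf≤ (inj₁ aᵏ-suffix) = DinfLe-padRight a a∈w (D-++-replicate _≟_ a k e aᵏ-suffix w-powers≤)
    Dinf≤ (inj₂ aᵏ-prefix) = DinfLe-padLeft a a∈w λ J →
      subst (λ d → D _≟_ (reverse w ++ replicate J a) ≤ d + e) (D-reverse _≟_ w)
        (D-++-replicate _≟_ a k e aᵏ-suffix-w̃ w̃-powers≤ J)
      where
      aᵏ-suffix-w̃ : Suffix (replicate k a) (reverse w)
      aᵏ-suffix-w̃ = subst (λ v → Suffix v (reverse w)) (sym (replicate-palindrome k a)) (Prefix-reverse aᵏ-prefix)

mainTheorem12 : {A : Set} (_≟_ : DecidableEquality A) (w : List A) → w ≢ [] →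
    (na : A → ℕ) → (∀ a → a ∈ w → IsLargestPower a w (na a)) →
    (n : ℕ) → IsMaxOverAlph w na n →
    DinfLe _≟_ w (D _≟_ w + n)
    × (∀ a k → a ∈ w → (Suffix (replicate k a) w ⊎ Prefix (replicate k a) w) →
         DinfLe _≟_ w (D _≟_ w + na a ∸ k))
mainTheorem12 _≟_ w _ na largest n ((a , a∈w , n≡na) , _) = Dinf≤D+n , Dinf≤D+na∸k
  where
  Dinf≤D+na∸k : ∀ a k → a ∈ w → (Suffix (replicate k a) w ⊎ Prefix (replicate k a) w) →
                DinfLe _≟_ w (D _≟_ w + na a ∸ k)
  Dinf≤D+na∸k a k a∈w = DinfLe-endPower _≟_ a k (na a) a∈w (proj₂ (largest a a∈w))
  Dinf≤D+n : DinfLe _≟_ w (D _≟_ w + n)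
  Dinf≤D+n = subst (λ m → DinfLe _≟_ w (D _≟_ w + m)) (sym n≡na)
               (Dinf≤D+na∸k a 0 a∈w (inj₁ (w , ++-identityʳ w)))
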